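{- Let $\sigma\in\mathfrak{S}_n$. Then \[ \sum_{v\in G(\sigma)} d_{\mathcal{B}}(v)=\left(\sum_{i\in\mathrm{Des}(\sigma)}\ \sum_{u\in G(\sigma s_i)} d_{\mathcal{B}}(u)\right)+2\sum_{i:\ i,i+1\in\mathrm{Des}(\sigma)}|\mathcal{R}(\sigma s_is_{i+1}s_i)|, \] where on the right $d_{\mathcal{B}}(u)$ is the braid degree of $u$ in $G(\sigma s_i)$, and on the left $d_{\mathcal{B}}(v)$ is the braid degree of $v$ in $G(\sigma)$.
   Context: $\mathfrak{S}_n$ is the symmetric group on $[n]$ with simple transpositions $s_i=(i\ i+1)$; $\ell$ is the inversion number; $\mathcal{R}(\sigma)$ is the set of reduced words of $\sigma$ (words $i_1\cdots i_l$ with $l=\ell(\sigma)$ and $\sigma=s_{i_1}\cdots s_{i_l}$); $\mathrm{Des}(\sigma)=\{i:\sigma(i)>\sigma(i+1)\}$. $G(\sigma)$ is the graph on $\mathcal{R}(\sigma)$ with commutation edges joining words related by a single move $ab\to ba$ on adjacent letters with $|a-b|>1$, and braid edges joining words related by a single move $a(a+1)a\leftrightarrow(a+1)a(a+1)$ on adjacent letters. $d_{\mathcal{B}}(v)$ denotes the number of braid edges incident to the vertex $v$. -}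

module Defs where

open import Data.Nat using (ℕ; zero; suc; _∸_; _+_)
open import Data.Nat.Properties using (_≟_)
open import Data.Fin using (Fin; toℕ) renaming (zero to fz; suc to fs)
import Data.Fin as F
import Data.Fin.Properties as FP
open import Data.List using (List; []; _∷_; _++_; map; concatMap; filter; length; upTo; allFin)
open import Data.Nat.ListAction using (sum)
import Data.List.Properties as LP
open import Data.List.Membership.DecPropositional (LP.≡-dec _≟_) using (_∈?_)
open import Data.Product using (_×_; _,_; Σ)
open import Data.Sum using (_⊎_)
open import Relation.Nullary using (Dec; yes; no; _×-dec_; _⊎-dec_)
open import Relation.Binary.PropositionalEquality using (_≡_)

-- Conventions: [n] = {1,…,n} is modelled by Fin n (0-based: Fin element x
-- stands for x+1).  Letters of words are natural numbers i ∈ {1,…,n-1}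
-- (1-based, as in the paper); s_i swaps the 1-based positions i and i+1,
-- i.e. the 0-based Fin elements i-1 and i.

-- swapAdj k : the adjacent transposition of the 0-based elements k, k+1
-- (identity when k+1 ≥ n).
swapAdj : {n : ℕ} → ℕ → Fin n → Fin n
swapAdj {suc (suc n)} zero fz = fs fz
swapAdj {suc (suc n)} zero (fs fz) = fz
swapAdj {suc (suc n)} zero (fs (fs x)) = fs (fs x)
swapAdj {suc zero} zero x = x
swapAdj {suc n} (suc k) fz = fz
swapAdj {suc n} (suc k) (fs x) = fs (swapAdj k x)

s : {n : ℕ} → ℕ → Fin n → Fin n
s i = swapAdj (i ∸ 1)

Word : Set
Word = List ℕ

eval : {n : ℕ} → Word → Fin n → Fin n
eval [] x = x
eval (a ∷ w) x = s a (eval w x)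

_·s_ : {n : ℕ} → (Fin n → Fin n) → ℕ → (Fin n → Fin n)
(f ·s i) x = f (s i x)

Inv : {n : ℕ} → (Fin n → Fin n) → Fin n × Fin n → Set
Inv f (x , y) = (x F.< y) × (f y F.< f x)

inv? : {n : ℕ} (f : Fin n → Fin n) (p : Fin n × Fin n) → Dec (Inv f p)
inv? f (x , y) = (x F.<? y) ×-dec (f y F.<? f x)

ℓ : {n : ℕ} → (Fin n → Fin n) → ℕ
ℓ {n} f = length (filter (inv? f) (concatMap (λ x → map (x ,_) (allFin n)) (allFin n)))

letters : ℕ → List ℕ
letters n = map suc (upTo (n ∸ 1))

words : ℕ → ℕ → List Word
words n zero = [] ∷ []
words n (suc l) = concatMap (λ a → map (a ∷_) (words n l)) (letters n)

IsWordOf : {n : ℕ} → (Fin n → Fin n) → Word → Set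
IsWordOf f w = ∀ x → f x ≡ eval w x

isWordOf? : {n : ℕ} (f : Fin n → Fin n) (w : Word) → Dec (IsWordOf f w)
isWordOf? f w = FP.all? (λ x → f x FP.≟ eval w x)

-- 𝓡(σ): reduced words (length ℓ(σ), product σ), as a duplicate-free list
𝓡 : {n : ℕ} → (Fin n → Fin n) → List Word
𝓡 {n} f = filter (isWordOf? f) (words n (ℓ f))

moveHead : Word → List Word
moveHead (a ∷ b ∷ c ∷ w) with (c ≟ a) ×-dec ((b ≟ suc a) ⊎-dec (a ≟ suc b))
... | yes _ = (b ∷ a ∷ b ∷ w) ∷ []
... | no _ = []
moveHead _ = []

braidNeighbours : Word → List Word
braidNeighbours [] = []
braidNeighbours (a ∷ w) = moveHead (a ∷ w) ++ map (a ∷_) (braidNeighbours w)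

d𝓑 : {n : ℕ} → (Fin n → Fin n) → Word → ℕ
d𝓑 f v = length (filter (λ u → u ∈? braidNeighbours v) (𝓡 f))

totalBraidDegree : {n : ℕ} → (Fin n → Fin n) → ℕ
totalBraidDegree f = sum (map (d𝓑 f) (𝓡 f))

IsDescent : {n : ℕ} → (Fin n → Fin n) → ℕ → Set
IsDescent {n} f i = Σ (Fin n) λ x → Σ (Fin n) λ y →
  (toℕ x ≡ i ∸ 1) × (toℕ y ≡ i) × (f y F.< f x)

isDescent? : {n : ℕ} (f : Fin n → Fin n) (i : ℕ) → Dec (IsDescent f i)
isDescent? f i = FP.any? (λ x → FP.any? (λ y →
  (toℕ x ≟ i ∸ 1) ×-dec ((toℕ y ≟ i) ×-dec (f y F.<? f x))))

Des : {n : ℕ} → (Fin n → Fin n) → List ℕ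
Des {n} f = filter (isDescent? f) (letters n)

DoubleDes : {n : ℕ} → (Fin n → Fin n) → List ℕ
DoubleDes {n} f = filter (λ i → isDescent? f i ×-dec isDescent? f (suc i)) (letters n)

-- A reduced word of σ can end in the letter a only if a ∈ Des(σ), and removing that a leaves a reduced
-- word of σ s_a.  A braid move on a word w·a either takes place inside w, and these moves make
-- up the braid degree of w in G(σ s_a), or it involves the final letter, so that w·a ends in i(i+1)i or
-- in (i+1)i(i+1).  Cutting off either ending leaves a reduced word of σ s_i s_{i+1} s_i = σ s_{i+1} s_i s_{i+1},
-- which requires ℓ to drop by 3, i.e. i, i+1 ∈ Des(σ).  So each pair of consecutive descents is counted
-- twice.  All counts are sums of indicators over the list  words n L  of all words of length L.

module Submission where

open import Defs
open import Data.Nat using (ℕ; _+_; _*_; suc)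
open import Data.List using (map; length)
open import Data.Nat.ListAction using (sum)
open import Data.Fin.Permutation using (Permutation′; _⟨$⟩ʳ_)
open import Relation.Binary.PropositionalEquality using (_≡_)

open import Data.Nat using (zero; _∸_; _≤_; _<_; z≤n; s≤s; s≤s⁻¹; _≟_; _<?_)
open import Data.Nat.Properties
open import Data.Nat.ListAction.Properties using (sum-++)
open import Data.List using (List; []; _∷_; _++_; _∷ʳ_; concatMap; filter; tabulate; allFin; upTo)
import Data.List.Properties as LP
open import Data.List.Membership.DecPropositional (LP.≡-dec _≟_) using (_∈?_; _∈_)
open import Data.List.Membership.Propositional.Properties using (∈-map⁺; ∈-map⁻; ∈-++⁺ˡ; ∈-++⁺ʳ; ∈-++⁻)
open import Data.List.Relation.Unary.All as All using (All; []; _∷_)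
import Data.List.Relation.Unary.All.Properties as AllP
open import Data.List.Relation.Unary.Any using (here; there)
open import Data.Fin using (Fin; toℕ) renaming (zero to fz; suc to fs)
import Data.Fin as F
import Data.Fin.Properties as FP
open import Data.Fin.Permutation using (permutation)
open import Data.Product using (Σ; _×_; _,_)
open import Data.Sum using (_⊎_; inj₁; inj₂)
open import Data.Empty using (⊥-elim)
open import Function using (_∘_; id)
open import Relation.Nullary using (Dec; yes; no; ¬_; _×-dec_; _⊎-dec_)
open import Relation.Nullary.Decidable using (map′)
open import Relation.Unary using (Pred; Decidable)
open import Relation.Binary.PropositionalEquality
open import Algebra.Properties.CommutativeSemigroup +-commutativeSemigroup using (interchange)
open import Algebra.Properties.Semiring.Sum +-*-semiring
  using (sum-syntax; ∑-distrib-+; sum-permute; sum-cong-≗; sum-replicate-zero; *-distribˡ-sum)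

n≢2+n : ∀ n → n ≢ suc (suc n)
n≢2+n n = <⇒≢ (<-trans (n<1+n n) (n<1+n (suc n)))

𝟙 : ∀ {p} {P : Set p} → Dec P → ℕ
𝟙 (yes _) = 1
𝟙 (no _) = 0

module _ {p} {P : Set p} where

  𝟙-yes : (d : Dec P) → P → 𝟙 d ≡ 1
  𝟙-yes (yes _) _ = refl
  𝟙-yes (no ¬p) p = ⊥-elim (¬p p)

  𝟙-no : (d : Dec P) → ¬ P → 𝟙 d ≡ 0
  𝟙-no (yes p) ¬p = ⊥-elim (¬p p)
  𝟙-no (no _) _ = refl

  𝟙-≤1 : (d : Dec P) → 𝟙 d ≤ 1
  𝟙-≤1 (yes _) = s≤s z≤n
  𝟙-≤1 (no _) = z≤n

module _ {p q} {P : Set p} {Q : Set q} where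

  𝟙-cong : (d : Dec P) (e : Dec Q) → (P → Q) → (Q → P) → 𝟙 d ≡ 𝟙 e
  𝟙-cong (yes _) (yes _) _ _ = refl
  𝟙-cong (yes p) (no ¬q) f _ = ⊥-elim (¬q (f p))
  𝟙-cong (no ¬p) (yes q) _ g = ⊥-elim (¬p (g q))
  𝟙-cong (no _) (no _) _ _ = refl

  𝟙-× : (d : Dec P) (e : Dec Q) → 𝟙 (d ×-dec e) ≡ 𝟙 d * 𝟙 e
  𝟙-× (yes _) (yes _) = refl
  𝟙-× (yes _) (no _) = refl
  𝟙-× (no _) (yes _) = refl
  𝟙-× (no _) (no _) = refl

  𝟙-⊎ : (d : Dec P) (e : Dec Q) → ¬ (P × Q) → 𝟙 (d ⊎-dec e) ≡ 𝟙 d + 𝟙 e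
  𝟙-⊎ (yes p) (yes q) disjoint = ⊥-elim (disjoint (p , q))
  𝟙-⊎ (yes _) (no _) _ = refl
  𝟙-⊎ (no _) (yes _) _ = refl
  𝟙-⊎ (no _) (no _) _ = refl

𝟙-suc-< : ∀ a b → 𝟙 (suc a <? suc b) ≡ 𝟙 (a <? b)
𝟙-suc-< a b = 𝟙-cong _ _ s≤s⁻¹ s≤s

𝟙-suc-≟ : ∀ a b → 𝟙 (suc a ≟ suc b) ≡ 𝟙 (a ≟ b)
𝟙-suc-≟ a b = 𝟙-cong _ _ suc-injective (cong suc)

𝟙-*-≡ : ∀ {p} {P : Set p} (d : Dec P) {x y} → (P → x ≡ y) → (¬ P → y ≡ 0) → 𝟙 d * x ≡ y
𝟙-*-≡ (yes p) x≡y _ = trans (+-identityʳ _) (x≡y p)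
𝟙-*-≡ (no ¬p) _ y≡0 = sym (y≡0 ¬p)

sumMap : ∀ {a} {A : Set a} → (A → ℕ) → List A → ℕ
sumMap h xs = sum (map h xs)

module _ {a} {A : Set a} where

  sumMap-++ : ∀ (h : A → ℕ) xs ys → sumMap h (xs ++ ys) ≡ sumMap h xs + sumMap h ys
  sumMap-++ h xs ys = trans (cong sum (LP.map-++ h xs ys)) (sum-++ (map h xs) (map h ys))

  sumMap-congᴬ : ∀ {h g : A → ℕ} {xs} → All (λ x → h x ≡ g x) xs → sumMap h xs ≡ sumMap g xs
  sumMap-congᴬ [] = refl
  sumMap-congᴬ (e ∷ es) = cong₂ _+_ e (sumMap-congᴬ es)

  sumMap-cong : ∀ {h g : A → ℕ} → (∀ x → h x ≡ g x) → ∀ xs → sumMap h xs ≡ sumMap g xs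
  sumMap-cong e xs = sumMap-congᴬ (All.universal e xs)

  sumMap-zeroᴬ : ∀ {h : A → ℕ} {xs} → All (λ x → h x ≡ 0) xs → sumMap h xs ≡ 0
  sumMap-zeroᴬ [] = refl
  sumMap-zeroᴬ (e ∷ es) rewrite e = sumMap-zeroᴬ es

  sumMap-+ : ∀ (h g : A → ℕ) xs → sumMap (λ x → h x + g x) xs ≡ sumMap h xs + sumMap g xs
  sumMap-+ h g [] = refl
  sumMap-+ h g (x ∷ xs) =
    trans (cong (h x + g x +_) (sumMap-+ h g xs)) (interchange (h x) (g x) (sumMap h xs) (sumMap g xs))

  sumMap-*ˡ : ∀ c (h : A → ℕ) xs → sumMap (λ x → c * h x) xs ≡ c * sumMap h xs
  sumMap-*ˡ c h [] = sym (*-zeroʳ c)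
  sumMap-*ˡ c h (x ∷ xs) = trans (cong (c * h x +_) (sumMap-*ˡ c h xs)) (sym (*-distribˡ-+ c (h x) _))

  sumMap-*ʳ : ∀ c (h : A → ℕ) xs → sumMap (λ x → h x * c) xs ≡ sumMap h xs * c
  sumMap-*ʳ c h [] = refl
  sumMap-*ʳ c h (x ∷ xs) = trans (cong (h x * c +_) (sumMap-*ʳ c h xs)) (sym (*-distribʳ-+ c (h x) _))

  length-filter : ∀ {p} {P : Pred A p} (P? : Decidable P) xs → length (filter P? xs) ≡ sumMap (λ x → 𝟙 (P? x)) xs
  length-filter P? [] = refl
  length-filter P? (x ∷ xs) with P? x
  ... | yes _ = cong suc (length-filter P? xs)
  ... | no _ = length-filter P? xs

  sumMap-filter : ∀ {p} {P : Pred A p} (P? : Decidable P) (h : A → ℕ) xs →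
    sumMap h (filter P? xs) ≡ sumMap (λ x → 𝟙 (P? x) * h x) xs
  sumMap-filter P? h [] = refl
  sumMap-filter P? h (x ∷ xs) with P? x
  ... | yes _ = cong₂ _+_ (sym (+-identityʳ (h x))) (sumMap-filter P? h xs)
  ... | no _ = sumMap-filter P? h xs

module _ {a b} {A : Set a} {B : Set b} where

  sumMap-map : ∀ (h : B → ℕ) (f : A → B) xs → sumMap h (map f xs) ≡ sumMap (λ x → h (f x)) xs
  sumMap-map h f xs = cong sum (sym (LP.map-∘ xs))

  sumMap-concatMap : ∀ (h : B → ℕ) (f : A → List B) xs →
    sumMap h (concatMap f xs) ≡ sumMap (λ x → sumMap h (f x)) xs
  sumMap-concatMap h f [] = refl
  sumMap-concatMap h f (x ∷ xs) =
    trans (sumMap-++ h (f x) (concatMap f xs)) (cong (sumMap h (f x) +_) (sumMap-concatMap h f xs))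

  sumMap-comm : ∀ (h : A → B → ℕ) xs ys →
    sumMap (λ x → sumMap (h x) ys) xs ≡ sumMap (λ y → sumMap (λ x → h x y) xs) ys
  sumMap-comm h [] ys = sym (sumMap-zeroᴬ (All.universal (λ _ → refl) ys))
  sumMap-comm h (x ∷ xs) ys =
    trans (cong (sumMap (h x) ys +_) (sumMap-comm h xs ys)) (sym (sumMap-+ (h x) (λ y → sumMap (λ x → h x y) xs) ys))

sumMap-tabulate : ∀ {n a} {A : Set a} (h : A → ℕ) (g : Fin n → A) → sumMap h (tabulate g) ≡ ∑[ x < n ] h (g x)
sumMap-tabulate {zero} h g = refl
sumMap-tabulate {suc n} h g = cong (h (g fz) +_) (sumMap-tabulate h (λ x → g (fs x)))

∑-zero : ∀ {n} {h : Fin n → ℕ} → (∀ x → h x ≡ 0) → ∑[ x < n ] h x ≡ 0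
∑-zero {n} e = trans (sum-cong-≗ e) (sum-replicate-zero n)

∑-pick : ∀ {n} (a : Fin n) (h : Fin n → ℕ) → ∑[ x < n ] (𝟙 (x F.≟ a) * h x) ≡ h a
∑-pick {suc n} fz h = begin
  𝟙 (fz {n} F.≟ fz) * h fz + ∑[ x < n ] (𝟙 (fs x F.≟ fz) * h (fs x))
    ≡⟨ cong₂ _+_ (cong (_* h fz) (𝟙-yes (fz {n} F.≟ fz) refl))
                 (∑-zero {n} λ x → cong (_* h (fs x)) (𝟙-no (fs x F.≟ fz) λ ())) ⟩
  1 * h fz + 0
    ≡⟨ trans (+-identityʳ _) (*-identityˡ _) ⟩
  h fz ∎
  where open ≡-Reasoning
∑-pick {suc n} (fs a) h = begin
  𝟙 (fz {n} F.≟ fs a) * h fz + ∑[ x < n ] (𝟙 (fs x F.≟ fs a) * h (fs x))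
    ≡⟨ cong₂ _+_ (cong (_* h fz) (𝟙-no (fz F.≟ fs a) λ ()))
                 (sum-cong-≗ {n} λ x → cong (_* h (fs x)) (𝟙-cong (fs x F.≟ fs a) (x F.≟ a) FP.suc-injective (cong fs))) ⟩
  ∑[ x < n ] (𝟙 (x F.≟ a) * h (fs x))
    ≡⟨ ∑-pick a (h ∘ fs) ⟩
  h (fs a) ∎
  where open ≡-Reasoning

module _ {n : ℕ} where

  ∑²-distrib-+ : (h g : Fin n → Fin n → ℕ) →
    ∑[ x < n ] ∑[ y < n ] (h x y + g x y) ≡ ∑[ x < n ] ∑[ y < n ] h x y + ∑[ x < n ] ∑[ y < n ] g x y
  ∑²-distrib-+ h g = trans (sum-cong-≗ {n} λ x → ∑-distrib-+ (h x) (g x))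
    (∑-distrib-+ (λ x → ∑[ y < n ] h x y) (λ x → ∑[ y < n ] g x y))

  ∑²-pick : (a b : Fin n) (h : Fin n → Fin n → ℕ) →
    ∑[ x < n ] ∑[ y < n ] (𝟙 (x F.≟ a) * 𝟙 (y F.≟ b) * h x y) ≡ h a b
  ∑²-pick a b h = trans (sum-cong-≗ {n} inner) (∑-pick a (λ x → h x b))
    where
    inner : ∀ x → ∑[ y < n ] (𝟙 (x F.≟ a) * 𝟙 (y F.≟ b) * h x y) ≡ 𝟙 (x F.≟ a) * h x b
    inner x = trans (sum-cong-≗ {n} λ y → *-assoc (𝟙 (x F.≟ a)) _ _)
                (trans (sym (*-distribˡ-sum (𝟙 (x F.≟ a)) (λ y → 𝟙 (y F.≟ b) * h x y)))
                       (cong (𝟙 (x F.≟ a) *_) (∑-pick b (h x))))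

swapAdj-involutive : ∀ {n} k (x : Fin n) → swapAdj k (swapAdj k x) ≡ x
swapAdj-involutive {suc (suc n)} zero fz = refl
swapAdj-involutive {suc (suc n)} zero (fs fz) = refl
swapAdj-involutive {suc (suc n)} zero (fs (fs x)) = refl
swapAdj-involutive {suc zero} zero x = refl
swapAdj-involutive {suc zero} (suc k) fz = refl
swapAdj-involutive {suc (suc n)} (suc k) fz = refl
swapAdj-involutive {suc (suc n)} (suc k) (fs x) = cong fs (swapAdj-involutive k x)

swapPermutation : ∀ {n} → ℕ → Permutation′ n
swapPermutation k = permutation (swapAdj k) (swapAdj k) (swapAdj-involutive k) (swapAdj-involutive k)

swapAdj-outOfRange : ∀ {n} k (x : Fin n) → ¬ suc k < n → swapAdj k x ≡ x
swapAdj-outOfRange {suc (suc n)} zero x k+1≮n = ⊥-elim (k+1≮n (s≤s (s≤s z≤n)))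
swapAdj-outOfRange {suc zero} zero x _ = refl
swapAdj-outOfRange {suc zero} (suc k) fz _ = refl
swapAdj-outOfRange {suc (suc n)} (suc k) fz _ = refl
swapAdj-outOfRange {suc (suc n)} (suc k) (fs x) k+1≮n = cong fs (swapAdj-outOfRange k x (k+1≮n ∘ s≤s))

swapAdj-braid : ∀ {n} k (x : Fin n) → suc (suc k) < n →
  swapAdj k (swapAdj (suc k) (swapAdj k x)) ≡ swapAdj (suc k) (swapAdj k (swapAdj (suc k) x))
swapAdj-braid {suc (suc (suc n))} zero fz _ = refl
swapAdj-braid {suc (suc (suc n))} zero (fs fz) _ = refl
swapAdj-braid {suc (suc (suc n))} zero (fs (fs fz)) _ = refl
swapAdj-braid {suc (suc (suc n))} zero (fs (fs (fs x))) _ = refl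
swapAdj-braid {suc zero} zero x (s≤s ())
swapAdj-braid {suc (suc zero)} zero x (s≤s (s≤s ()))
swapAdj-braid {suc zero} (suc k) fz _ = refl
swapAdj-braid {suc (suc n)} (suc k) fz _ = refl
swapAdj-braid {suc (suc n)} (suc k) (fs x) k+2<n = cong fs (swapAdj-braid k x (s≤s⁻¹ k+2<n))

transposeℕ : ℕ → ℕ → ℕ
transposeℕ zero zero = 1
transposeℕ zero (suc zero) = 0
transposeℕ zero (suc (suc u)) = suc (suc u)
transposeℕ (suc k) zero = zero
transposeℕ (suc k) (suc u) = suc (transposeℕ k u)

toℕ-swapAdj : ∀ {n} k (x : Fin n) → suc k < n → toℕ (swapAdj k x) ≡ transposeℕ k (toℕ x)
toℕ-swapAdj {suc (suc n)} zero fz _ = refl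
toℕ-swapAdj {suc (suc n)} zero (fs fz) _ = refl
toℕ-swapAdj {suc (suc n)} zero (fs (fs x)) _ = refl
toℕ-swapAdj {suc zero} zero x (s≤s ())
toℕ-swapAdj {suc zero} (suc k) fz _ = refl
toℕ-swapAdj {suc (suc n)} (suc k) fz _ = refl
toℕ-swapAdj {suc (suc n)} (suc k) (fs x) k+1<n = cong suc (toℕ-swapAdj k x (s≤s⁻¹ k+1<n))

transposeℕ-left : ∀ k → transposeℕ k k ≡ suc k
transposeℕ-left zero = refl
transposeℕ-left (suc k) = cong suc (transposeℕ-left k)

transposeℕ-other : ∀ k u → u ≢ k → u ≢ suc k → transposeℕ k u ≡ u
transposeℕ-other zero zero u≢k _ = ⊥-elim (u≢k refl)
transposeℕ-other zero (suc zero) _ u≢k+1 = ⊥-elim (u≢k+1 refl)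
transposeℕ-other zero (suc (suc u)) _ _ = refl
transposeℕ-other (suc k) zero _ _ = refl
transposeℕ-other (suc k) (suc u) u≢k u≢k+1 = cong suc (transposeℕ-other k u (u≢k ∘ cong suc) (u≢k+1 ∘ cong suc))

-- Transposing k and k+1 preserves the order of every pair except (k, k+1), which it reverses.
transposeℕ-order : ∀ k u v →
  𝟙 (transposeℕ k u <? transposeℕ k v) + 𝟙 (u ≟ k) * 𝟙 (v ≟ suc k) ≡ 𝟙 (u <? v) + 𝟙 (u ≟ suc k) * 𝟙 (v ≟ k)
transposeℕ-order zero zero zero = refl
transposeℕ-order zero zero (suc zero) = refl
transposeℕ-order zero zero (suc (suc v)) = refl
transposeℕ-order zero (suc zero) zero = refl
transposeℕ-order zero (suc zero) (suc zero) = refl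
transposeℕ-order zero (suc zero) (suc (suc v)) = refl
transposeℕ-order zero (suc (suc u)) zero = refl
transposeℕ-order zero (suc (suc u)) (suc zero) = refl
transposeℕ-order zero (suc (suc u)) (suc (suc v)) = refl
transposeℕ-order (suc k) zero zero = refl
transposeℕ-order (suc k) zero (suc v) = refl
transposeℕ-order (suc k) (suc u) zero
  rewrite *-zeroʳ (𝟙 (suc u ≟ suc k)) | *-zeroʳ (𝟙 (suc u ≟ suc (suc k))) = refl
transposeℕ-order (suc k) (suc u) (suc v)
  rewrite 𝟙-suc-< (transposeℕ k u) (transposeℕ k v) | 𝟙-suc-≟ u k | 𝟙-suc-≟ v (suc k)
        | 𝟙-suc-< u v | 𝟙-suc-≟ u (suc k) | 𝟙-suc-≟ v k = transposeℕ-order k u v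

𝟙-toℕ-≟ : ∀ {n} (x a : Fin n) {k} → toℕ a ≡ k → 𝟙 (x F.≟ a) ≡ 𝟙 (toℕ x ≟ k)
𝟙-toℕ-≟ x a refl = 𝟙-cong _ _ (cong toℕ) FP.toℕ-injective

swapAdj-order : ∀ {n} k {a b : Fin n} → toℕ a ≡ k → toℕ b ≡ suc k → ∀ x y →
  𝟙 (swapAdj k x F.<? swapAdj k y) + 𝟙 (x F.≟ a) * 𝟙 (y F.≟ b) ≡ 𝟙 (x F.<? y) + 𝟙 (x F.≟ b) * 𝟙 (y F.≟ a)
swapAdj-order {n} k {a} {b} a≡k b≡k+1 x y
  rewrite 𝟙-toℕ-≟ x a a≡k | 𝟙-toℕ-≟ y b b≡k+1 | 𝟙-toℕ-≟ x b b≡k+1 | 𝟙-toℕ-≟ y a a≡k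
        | toℕ-swapAdj k x (subst (_< n) b≡k+1 (FP.toℕ<n b))
        | toℕ-swapAdj k y (subst (_< n) b≡k+1 (FP.toℕ<n b)) = transposeℕ-order k (toℕ x) (toℕ y)

module _ {n : ℕ} where

  ∑²-permute : (π : Permutation′ n) (h : Fin n → Fin n → ℕ) →
    ∑[ x < n ] ∑[ y < n ] h x y ≡ ∑[ x < n ] ∑[ y < n ] h (π ⟨$⟩ʳ x) (π ⟨$⟩ʳ y)
  ∑²-permute π h =
    trans (sum-cong-≗ {n} λ x → sum-permute (h x) π) (sum-permute (λ x → ∑[ y < n ] h x (π ⟨$⟩ʳ y)) π)

  reverses : (Fin n → Fin n) → Fin n → Fin n → ℕ
  reverses g u v = 𝟙 (g v F.<? g u)

  ℓ-as-sum : (g : Fin n → Fin n) → ℓ g ≡ ∑[ x < n ] ∑[ y < n ] (𝟙 (x F.<? y) * reverses g x y)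
  ℓ-as-sum g = begin
    length (filter (inv? g) pairs)                                   ≡⟨ length-filter (inv? g) pairs ⟩
    sumMap (𝟙 ∘ inv? g) pairs                                        ≡⟨ sumMap-concatMap _ row (allFin n) ⟩
    sumMap (λ x → sumMap (𝟙 ∘ inv? g) (row x)) (allFin n)            ≡⟨ sumMap-tabulate {n} _ (λ x → x) ⟩
    ∑[ x < n ] sumMap (𝟙 ∘ inv? g) (row x)                           ≡⟨ sum-cong-≗ {n} rowSum ⟩
    ∑[ x < n ] ∑[ y < n ] (𝟙 (x F.<? y) * reverses g x y)           ∎
    where
    open ≡-Reasoning
    row : Fin n → List (Fin n × Fin n)
    row x = map (x ,_) (allFin n)
    pairs = concatMap row (allFin n)
    rowSum : ∀ x → sumMap (𝟙 ∘ inv? g) (row x) ≡ ∑[ y < n ] (𝟙 (x F.<? y) * reverses g x y)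
    rowSum x = trans (sumMap-map _ (x ,_) (allFin n))
      (trans (sumMap-tabulate {n} _ (λ y → y)) (sum-cong-≗ {n} λ y → 𝟙-× (x F.<? y) (g y F.<? g x)))

  ℓ-cong : {g h : Fin n → Fin n} → (∀ x → g x ≡ h x) → ℓ g ≡ ℓ h
  ℓ-cong {g} {h} g≗h = trans (ℓ-as-sum g) (trans (sum-cong-≗ {n} λ x → sum-cong-≗ {n} λ y → cong (𝟙 (x F.<? y) *_)
    (𝟙-cong _ _ (subst₂ F._<_ (g≗h y) (g≗h x)) (subst₂ F._<_ (sym (g≗h y)) (sym (g≗h x))))) (sym (ℓ-as-sum h)))

  -- g ∘ swapAdj k is g ·s suc k; reindexing the inversion sum by the transposition shows that only
  -- the pair of positions k, k+1 changes its status.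
  ℓ-∘swapAdj : (g : Fin n → Fin n) (k : ℕ) {a b : Fin n} → toℕ a ≡ k → toℕ b ≡ suc k →
    ℓ (g ∘ swapAdj k) + reverses g a b ≡ ℓ g + reverses g b a
  ℓ-∘swapAdj g k {a} {b} a≡k b≡k+1 = begin
    ℓ (g ∘ sw) + R a b
      ≡⟨ cong₂ _+_ (trans (ℓ-as-sum (g ∘ sw)) reindex) (sym (∑²-pick a b R)) ⟩
    ∑[ x < n ] ∑[ y < n ] (𝟙 (sw x F.<? sw y) * R x y) + ∑[ x < n ] ∑[ y < n ] (𝟙 (x F.≟ a) * 𝟙 (y F.≟ b) * R x y)
      ≡⟨ sym (∑²-distrib-+ (λ x y → 𝟙 (sw x F.<? sw y) * R x y) (λ x y → 𝟙 (x F.≟ a) * 𝟙 (y F.≟ b) * R x y)) ⟩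
    ∑[ x < n ] ∑[ y < n ] (𝟙 (sw x F.<? sw y) * R x y + 𝟙 (x F.≟ a) * 𝟙 (y F.≟ b) * R x y)
      ≡⟨ sum-cong-≗ {n} (λ x → sum-cong-≗ {n} λ y → swapped x y) ⟩
    ∑[ x < n ] ∑[ y < n ] (𝟙 (x F.<? y) * R x y + 𝟙 (x F.≟ b) * 𝟙 (y F.≟ a) * R x y)
      ≡⟨ ∑²-distrib-+ (λ x y → 𝟙 (x F.<? y) * R x y) (λ x y → 𝟙 (x F.≟ b) * 𝟙 (y F.≟ a) * R x y) ⟩
    ∑[ x < n ] ∑[ y < n ] (𝟙 (x F.<? y) * R x y) + ∑[ x < n ] ∑[ y < n ] (𝟙 (x F.≟ b) * 𝟙 (y F.≟ a) * R x y)
      ≡⟨ cong₂ _+_ (sym (ℓ-as-sum g)) (∑²-pick b a R) ⟩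
    ℓ g + R b a ∎
    where
    open ≡-Reasoning
    sw = swapAdj k
    R = reverses g
    reindex : ∑[ x < n ] ∑[ y < n ] (𝟙 (x F.<? y) * R (sw x) (sw y)) ≡ ∑[ x < n ] ∑[ y < n ] (𝟙 (sw x F.<? sw y) * R x y)
    reindex = sym (trans (∑²-permute (swapPermutation k) (λ x y → 𝟙 (sw x F.<? sw y) * R x y))
      (sum-cong-≗ {n} λ x → sum-cong-≗ {n} λ y →
        cong₂ (λ u v → 𝟙 (u F.<? v) * R (sw x) (sw y)) (swapAdj-involutive k x) (swapAdj-involutive k y)))
    swapped : ∀ x y → 𝟙 (sw x F.<? sw y) * R x y + 𝟙 (x F.≟ a) * 𝟙 (y F.≟ b) * R x y
                    ≡ 𝟙 (x F.<? y) * R x y + 𝟙 (x F.≟ b) * 𝟙 (y F.≟ a) * R x y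
    swapped x y = trans (sym (*-distribʳ-+ (R x y) (𝟙 (sw x F.<? sw y)) (𝟙 (x F.≟ a) * 𝟙 (y F.≟ b))))
      (trans (cong (_* R x y) (swapAdj-order k a≡k b≡k+1 x y))
             (*-distribʳ-+ (R x y) (𝟙 (x F.<? y)) (𝟙 (x F.≟ b) * 𝟙 (y F.≟ a))))

module _ {n : ℕ} where

  ¬isDescent-0 : (g : Fin n → Fin n) → ¬ IsDescent g 0
  ¬isDescent-0 g (x , y , x≡0 , y≡0 , gy<gx) rewrite FP.toℕ-injective {i = x} {j = y} (trans x≡0 (sym y≡0)) =
    <-irrefl refl gy<gx

  isDescent⇒< : (g : Fin n → Fin n) {i : ℕ} → IsDescent g i → i < n
  isDescent⇒< g (_ , y , _ , refl , _) = FP.toℕ<n y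

  adjacentPair : ∀ k → suc k < n → Σ (Fin n) λ a → Σ (Fin n) λ b → toℕ a ≡ k × toℕ b ≡ suc k
  adjacentPair k k+1<n = F.fromℕ< (<-trans (n<1+n k) k+1<n) , F.fromℕ< k+1<n ,
    FP.toℕ-fromℕ< (<-trans (n<1+n k) k+1<n) , FP.toℕ-fromℕ< k+1<n

  ℓ-∘swapAdj-outOfRange : (g : Fin n → Fin n) (k : ℕ) → ¬ suc k < n → ℓ (g ∘ swapAdj k) ≡ ℓ g
  ℓ-∘swapAdj-outOfRange g k k+1≮n = ℓ-cong λ x → cong g (swapAdj-outOfRange k x k+1≮n)

  ℓ-·s-descent : (g : Fin n → Fin n) (i : ℕ) → IsDescent g i → suc (ℓ (g ·s i)) ≡ ℓ g
  ℓ-·s-descent g zero d = ⊥-elim (¬isDescent-0 g d)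
  ℓ-·s-descent g (suc k) (a , b , a≡k , b≡k+1 , gb<ga) = begin
    suc (ℓ (g ·s suc k))             ≡⟨ +-comm 1 _ ⟩
    ℓ (g ·s suc k) + 1               ≡⟨ cong (ℓ (g ·s suc k) +_) (𝟙-yes (g b F.<? g a) gb<ga) ⟨
    ℓ (g ·s suc k) + reverses g a b  ≡⟨ ℓ-∘swapAdj g k a≡k b≡k+1 ⟩
    ℓ g + reverses g b a             ≡⟨ cong (ℓ g +_) (𝟙-no (g a F.<? g b) (<-asym gb<ga)) ⟩
    ℓ g + 0                          ≡⟨ +-identityʳ (ℓ g) ⟩
    ℓ g                              ∎
    where open ≡-Reasoning

  -- Only for letters suc k: truncated subtraction makes s 0 = s 1.
  ℓ-·s-ascent : (g : Fin n → Fin n) (k : ℕ) → ¬ IsDescent g (suc k) → ℓ g ≤ ℓ (g ·s suc k)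
  ℓ-·s-ascent g k ¬d with suc k <? n
  ... | no k+1≮n = ≤-reflexive (sym (ℓ-∘swapAdj-outOfRange g k k+1≮n))
  ... | yes k+1<n with adjacentPair k k+1<n
  ...   | a , b , a≡k , b≡k+1 = begin
    ℓ g                              ≤⟨ m≤m+n (ℓ g) (reverses g b a) ⟩
    ℓ g + reverses g b a             ≡⟨ ℓ-∘swapAdj g k a≡k b≡k+1 ⟨
    ℓ (g ·s suc k) + reverses g a b  ≡⟨ cong (ℓ (g ·s suc k) +_)
                                          (𝟙-no (g b F.<? g a) λ gb<ga → ¬d (a , b , a≡k , b≡k+1 , gb<ga)) ⟩
    ℓ (g ·s suc k) + 0               ≡⟨ +-identityʳ _ ⟩
    ℓ (g ·s suc k)                   ∎
    where open ≤-Reasoning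

  ℓ-≤-∘swapAdj : (g : Fin n → Fin n) (k : ℕ) → ℓ g ≤ suc (ℓ (g ∘ swapAdj k))
  ℓ-≤-∘swapAdj g k with suc k <? n
  ... | no k+1≮n = ≤-trans (≤-reflexive (sym (ℓ-∘swapAdj-outOfRange g k k+1≮n))) (n≤1+n _)
  ... | yes k+1<n with adjacentPair k k+1<n
  ...   | a , b , a≡k , b≡k+1 = begin
    ℓ g                                 ≤⟨ m≤m+n (ℓ g) (reverses g b a) ⟩
    ℓ g + reverses g b a                ≡⟨ ℓ-∘swapAdj g k a≡k b≡k+1 ⟨
    ℓ (g ∘ swapAdj k) + reverses g a b  ≤⟨ +-monoʳ-≤ _ (𝟙-≤1 (g b F.<? g a)) ⟩
    ℓ (g ∘ swapAdj k) + 1               ≡⟨ +-comm _ 1 ⟩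
    suc (ℓ (g ∘ swapAdj k))             ∎
    where open ≤-Reasoning

  ℓ-∘swapAdj-≤ : (g : Fin n → Fin n) (k : ℕ) → ℓ (g ∘ swapAdj k) ≤ suc (ℓ g)
  ℓ-∘swapAdj-≤ g k = ≤-trans (ℓ-≤-∘swapAdj (g ∘ swapAdj k) k)
    (≤-reflexive (cong suc (ℓ-cong λ x → cong g (swapAdj-involutive k x))))

  ℓ-id : ℓ {n} (λ x → x) ≡ 0
  ℓ-id = trans (ℓ-as-sum {n} (λ x → x)) (∑-zero {n} λ x → ∑-zero {n} λ y → noCycle x y)
    where
    noCycle : ∀ x y → 𝟙 (x F.<? y) * 𝟙 (y F.<? x) ≡ 0
    noCycle x y with x F.<? y
    ... | yes x<y = cong (1 *_) (𝟙-no (y F.<? x) (<-asym x<y))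
    ... | no _ = refl

  ℓ-∘eval-≤ : (g : Fin n → Fin n) (w : Word) → ℓ (g ∘ eval w) ≤ length w + ℓ g
  ℓ-∘eval-≤ g [] = ≤-refl
  ℓ-∘eval-≤ g (a ∷ w) = begin
    ℓ ((g ∘ s a) ∘ eval w)    ≤⟨ ℓ-∘eval-≤ (g ∘ s a) w ⟩
    length w + ℓ (g ∘ s a)    ≤⟨ +-monoʳ-≤ (length w) (ℓ-∘swapAdj-≤ g (a ∸ 1)) ⟩
    length w + suc (ℓ g)      ≡⟨ +-suc (length w) (ℓ g) ⟩
    length (a ∷ w) + ℓ g      ∎
    where open ≤-Reasoning

  ℓ-≤-length : {g : Fin n → Fin n} {w : Word} → IsWordOf g w → ℓ g ≤ length w
  ℓ-≤-length {g} {w} g≗w = begin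
    ℓ g                        ≡⟨ ℓ-cong g≗w ⟩
    ℓ {n} ((λ x → x) ∘ eval w) ≤⟨ ℓ-∘eval-≤ (λ x → x) w ⟩
    length w + ℓ {n} (λ x → x) ≡⟨ cong (length w +_) ℓ-id ⟩
    length w + 0               ≡⟨ +-identityʳ (length w) ⟩
    length w                   ∎
    where open ≤-Reasoning

braidTriple : ∀ {n} → (Fin n → Fin n) → ℕ → Fin n → Fin n
braidTriple f i = ((f ·s i) ·s suc i) ·s i

module _ {n : ℕ} where

  swapAdj-left : ∀ k {x y : Fin n} → toℕ x ≡ k → toℕ y ≡ suc k → swapAdj k x ≡ y
  swapAdj-left k {x} {y} refl y≡k+1 = FP.toℕ-injective (begin
    toℕ (swapAdj k x)         ≡⟨ toℕ-swapAdj k x (subst (_< n) y≡k+1 (FP.toℕ<n y)) ⟩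
    transposeℕ k k            ≡⟨ transposeℕ-left k ⟩
    suc k                     ≡⟨ y≡k+1 ⟨
    toℕ y                     ∎)
    where open ≡-Reasoning

  swapAdj-right : ∀ k {x y : Fin n} → toℕ x ≡ k → toℕ y ≡ suc k → swapAdj k y ≡ x
  swapAdj-right k {x} {y} x≡k y≡k+1 =
    trans (cong (swapAdj k) (sym (swapAdj-left k x≡k y≡k+1))) (swapAdj-involutive k x)

  swapAdj-fixes : ∀ k {x : Fin n} → toℕ x ≢ k → toℕ x ≢ suc k → swapAdj k x ≡ x
  swapAdj-fixes k {x} x≢k x≢k+1 with suc k <? n
  ... | yes k+1<n = FP.toℕ-injective (trans (toℕ-swapAdj k x k+1<n) (transposeℕ-other k (toℕ x) x≢k x≢k+1))
  ... | no k+1≮n = swapAdj-outOfRange k x k+1≮n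

  ℓ-braidTriple-doubleDescent : (f : Fin n → Fin n) (i : ℕ) → IsDescent f i → IsDescent f (suc i) →
    3 + ℓ (braidTriple f i) ≡ ℓ f
  ℓ-braidTriple-doubleDescent f zero d₁ _ = ⊥-elim (¬isDescent-0 f d₁)
  ℓ-braidTriple-doubleDescent f (suc j)
    d₁@(x₀ , x₁ , x₀≡j , x₁≡j+1 , fx₁<fx₀) (y₁ , y₂ , y₁≡j+1 , y₂≡j+2 , fy₂<fy₁)
    rewrite FP.toℕ-injective {i = y₁} {j = x₁} (trans y₁≡j+1 (sym x₁≡j+1)) = begin
    suc (suc (suc (ℓ g₃)))  ≡⟨ cong (suc ∘ suc) (ℓ-·s-descent g₂ (suc j) d₃) ⟩
    suc (suc (ℓ g₂))        ≡⟨ cong suc (ℓ-·s-descent g₁ (suc (suc j)) d₂) ⟩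
    suc (ℓ g₁)              ≡⟨ ℓ-·s-descent f (suc j) d₁ ⟩
    ℓ f                     ∎
    where
    open ≡-Reasoning
    g₁ = f ·s suc j
    g₂ = g₁ ·s suc (suc j)
    g₃ = g₂ ·s suc j
    y₂-fixed : swapAdj j y₂ ≡ y₂
    y₂-fixed = swapAdj-fixes j (λ e → n≢2+n j (trans (sym e) y₂≡j+2)) (λ e → 1+n≢n (trans (sym y₂≡j+2) e))
    x₀-fixed : swapAdj (suc j) x₀ ≡ x₀
    x₀-fixed = swapAdj-fixes (suc j) (λ e → 1+n≢n (trans (sym e) x₀≡j)) (λ e → n≢2+n j (trans (sym x₀≡j) e))
    d₂ : IsDescent g₁ (suc (suc j))
    d₂ = x₁ , y₂ , x₁≡j+1 , y₂≡j+2 ,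
      subst₂ (λ u v → f u F.< f v) (sym y₂-fixed) (sym (swapAdj-right j x₀≡j x₁≡j+1)) (FP.<-trans fy₂<fy₁ fx₁<fx₀)
    d₃ : IsDescent g₂ (suc j)
    d₃ = x₀ , x₁ , x₀≡j , x₁≡j+1 , subst₂ (λ u v → f u F.< f v)
      (sym (trans (cong (swapAdj j) (swapAdj-left (suc j) x₁≡j+1 y₂≡j+2)) y₂-fixed))
      (sym (trans (cong (swapAdj j) x₀-fixed) (swapAdj-left j x₀≡j x₁≡j+1)))
      fy₂<fy₁

  ℓ-≤-braidTriple-ofAscent : (g : Fin n → Fin n) (a b : ℕ) → ℓ g ≤ ℓ (g ·s a) → ℓ g ≤ 2 + ℓ (((g ·s a) ·s b) ·s a)
  ℓ-≤-braidTriple-ofAscent g a b ascent = begin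
    ℓ g                                  ≤⟨ ascent ⟩
    ℓ (g ·s a)                           ≤⟨ ℓ-≤-∘swapAdj (g ·s a) (b ∸ 1) ⟩
    suc (ℓ ((g ·s a) ·s b))              ≤⟨ s≤s (ℓ-≤-∘swapAdj ((g ·s a) ·s b) (a ∸ 1)) ⟩
    2 + ℓ (((g ·s a) ·s b) ·s a)         ∎
    where open ≤-Reasoning

  ℓ-≤-braidTriple : (f : Fin n → Fin n) (j : ℕ) → ¬ (IsDescent f (suc j) × IsDescent f (suc (suc j))) →
    ℓ f ≤ 2 + ℓ (braidTriple f (suc j))
  ℓ-≤-braidTriple f j ¬dd with isDescent? f (suc j)
  ... | no ¬d₁ = ℓ-≤-braidTriple-ofAscent f (suc j) (suc (suc j)) (ℓ-·s-ascent f j ¬d₁)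
  ... | yes d₁ with suc (suc j) <? n
  ...   | yes j+2<n = subst (λ m → ℓ f ≤ 2 + m) (ℓ-cong λ x → cong f (sym (swapAdj-braid j x j+2<n)))
          (ℓ-≤-braidTriple-ofAscent f (suc (suc j)) (suc j) (ℓ-·s-ascent f (suc j) λ d₂ → ¬dd (d₁ , d₂)))
  ...   | no j+2≮n = ≤-trans (≤-reflexive (ℓ-cong λ x → cong f (sym (trans
            (cong (swapAdj j) (swapAdj-outOfRange (suc j) (swapAdj j x) j+2≮n)) (swapAdj-involutive j x)))))
          (m≤n+m _ 2)

sumMap-upTo-suc : ∀ (F : ℕ → ℕ) m → sumMap F (upTo (suc m)) ≡ F 0 + sumMap (F ∘ suc) (upTo m)
sumMap-upTo-suc F m = cong (F 0 +_) (trans (cong (sumMap F) (sym (LP.map-applyUpTo id suc m))) (sumMap-map F suc (upTo m)))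

sumMap-upTo-shift : ∀ (F : ℕ → ℕ) m → sumMap F (upTo m) + F m ≡ F 0 + sumMap (F ∘ suc) (upTo m)
sumMap-upTo-shift F m = begin
  sumMap F (upTo m) + F m              ≡⟨ cong (sumMap F (upTo m) +_) (+-identityʳ (F m)) ⟨
  sumMap F (upTo m) + sumMap F (m ∷ []) ≡⟨ sumMap-++ F (upTo m) (m ∷ []) ⟨
  sumMap F (upTo m ∷ʳ m)               ≡⟨ cong (sumMap F) (LP.upTo-∷ʳ m) ⟩
  sumMap F (upTo (suc m))              ≡⟨ sumMap-upTo-suc F m ⟩
  F 0 + sumMap (F ∘ suc) (upTo m)      ∎
  where open ≡-Reasoning

sumMap-upTo-pick : ∀ (F : ℕ → ℕ) c m → sumMap (λ j → 𝟙 (j ≟ c) * F j) (upTo m) ≡ 𝟙 (c <? m) * F c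
sumMap-upTo-pick F c zero = refl
sumMap-upTo-pick F zero (suc m) = trans (sumMap-upTo-suc _ m)
  (trans (cong (F 0 + 0 +_) (sumMap-zeroᴬ (All.universal (λ _ → refl) (upTo m)))) (+-identityʳ (F 0 + 0)))
sumMap-upTo-pick F (suc c) (suc m) = begin
  sumMap (λ j → 𝟙 (j ≟ suc c) * F j) (upTo (suc m))        ≡⟨ sumMap-upTo-suc (λ j → 𝟙 (j ≟ suc c) * F j) m ⟩
  sumMap (λ j → 𝟙 (suc j ≟ suc c) * F (suc j)) (upTo m)    ≡⟨ sumMap-cong (λ j → cong (_* F (suc j))
                                                                 (𝟙-suc-≟ j c)) (upTo m) ⟩
  sumMap (λ j → 𝟙 (j ≟ c) * F (suc j)) (upTo m)            ≡⟨ sumMap-upTo-pick (F ∘ suc) c m ⟩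
  𝟙 (c <? m) * F (suc c)                                    ≡⟨ cong (_* F (suc c)) (sym (𝟙-suc-< c m)) ⟩
  𝟙 (suc c <? suc m) * F (suc c)                            ∎
  where open ≡-Reasoning

1+m<n⇒m<n∸1 : ∀ {m n} → suc m < n → m < n ∸ 1
1+m<n⇒m<n∸1 {n = suc n} (s≤s m<n) = m<n

IsLetter : ℕ → ℕ → Set
IsLetter n c = Σ ℕ λ j → c ≡ suc j × j < n ∸ 1

isLetter? : ∀ n c → Dec (IsLetter n c)
isLetter? n zero = no λ ()
isLetter? n (suc j) = map′ (λ j<n-1 → j , refl , j<n-1) (λ { (_ , refl , j<n-1) → j<n-1 }) (j <? n ∸ 1)

letters-isLetter : ∀ n → All (IsLetter n) (letters n)
letters-isLetter n = AllP.map⁺ (AllP.applyUpTo⁺₁ id (n ∸ 1) λ {j} j<n-1 → j , refl , j<n-1)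

isLetter⇒< : ∀ {n c} → IsLetter n c → c < n
isLetter⇒< {suc n} (j , refl , j<n-1) = s≤s j<n-1

sumMap-letters : ∀ n (h : ℕ → ℕ) → sumMap h (letters n) ≡ sumMap (h ∘ suc) (upTo (n ∸ 1))
sumMap-letters n h = sumMap-map h suc (upTo (n ∸ 1))

sumMap-letters-pick : ∀ n (K : ℕ → ℕ) c → sumMap (λ y → 𝟙 (y ≟ c) * K y) (letters n) ≡ 𝟙 (isLetter? n c) * K c
sumMap-letters-pick n K zero = trans (sumMap-letters n _) (sumMap-zeroᴬ (All.universal (λ _ → refl) (upTo (n ∸ 1))))
sumMap-letters-pick n K (suc c) = begin
  sumMap (λ y → 𝟙 (y ≟ suc c) * K y) (letters n)                ≡⟨ sumMap-letters n _ ⟩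
  sumMap (λ j → 𝟙 (suc j ≟ suc c) * K (suc j)) (upTo (n ∸ 1))   ≡⟨ sumMap-cong (λ j → cong (_* K (suc j))
                                                                      (𝟙-suc-≟ j c)) (upTo (n ∸ 1)) ⟩
  sumMap (λ j → 𝟙 (j ≟ c) * K (suc j)) (upTo (n ∸ 1))           ≡⟨ sumMap-upTo-pick (K ∘ suc) c (n ∸ 1) ⟩
  𝟙 (c <? n ∸ 1) * K (suc c)                                     ≡⟨ cong (_* K (suc c)) (𝟙-cong (c <? n ∸ 1) (isLetter? n (suc c))
                                                                      (λ c<n-1 → c , refl , c<n-1) λ { (_ , refl , c<n-1) → c<n-1 }) ⟩
  𝟙 (isLetter? n (suc c)) * K (suc c)                            ∎
  where open ≡-Reasoning

sumMap-letters-pickLetter : ∀ n (K : ℕ → ℕ) {c} → IsLetter n c → sumMap (λ y → 𝟙 (y ≟ c) * K y) (letters n) ≡ K c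
sumMap-letters-pickLetter n K {c} c∈ = trans (sumMap-letters-pick n K c)
  (trans (cong (_* K c) (𝟙-yes (isLetter? n c) c∈)) (+-identityʳ (K c)))

infix 4 _≟ʷ_
_≟ʷ_ : (u v : Word) → Dec (u ≡ v)
_≟ʷ_ = LP.≡-dec _≟_

IsWordOver : ℕ → ℕ → Word → Set
IsWordOver n L v = length v ≡ L × All (IsLetter n) v

words-isWordOver : ∀ n L → All (IsWordOver n L) (words n L)
words-isWordOver n zero = (refl , []) ∷ []
words-isWordOver n (suc L) = AllP.concat⁺ (AllP.map⁺ (All.map prepend (letters-isLetter n)))
  where
  prepend : ∀ {a} → IsLetter n a → All (IsWordOver n (suc L)) (map (a ∷_) (words n L))
  prepend a∈ = AllP.map⁺ (All.map (λ (|w|≡L , w∈) → cong suc |w|≡L , a∈ ∷ w∈) (words-isWordOver n L))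

sumMap-words-head : ∀ n L (h : Word → ℕ) →
  sumMap h (words n (suc L)) ≡ sumMap (λ a → sumMap (λ w → h (a ∷ w)) (words n L)) (letters n)
sumMap-words-head n L h =
  trans (sumMap-concatMap h _ (letters n)) (sumMap-cong (λ a → sumMap-map h (a ∷_) (words n L)) (letters n))

sumMap-words-last : ∀ n L (h : Word → ℕ) →
  sumMap h (words n (suc L)) ≡ sumMap (λ a → sumMap (λ w → h (w ∷ʳ a)) (words n L)) (letters n)
sumMap-words-last n zero h = sumMap-words-head n zero h
sumMap-words-last n (suc L) h = begin
  sumMap h (words n (suc (suc L)))
    ≡⟨ sumMap-words-head n (suc L) h ⟩
  sumMap (λ b → sumMap (λ v → h (b ∷ v)) (words n (suc L))) (letters n)
    ≡⟨ sumMap-cong (λ b → sumMap-words-last n L (λ v → h (b ∷ v))) (letters n) ⟩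
  sumMap (λ b → sumMap (λ a → sumMap (λ w → h (b ∷ w ∷ʳ a)) (words n L)) (letters n)) (letters n)
    ≡⟨ sumMap-comm (λ b a → sumMap (λ w → h (b ∷ w ∷ʳ a)) (words n L)) (letters n) (letters n) ⟩
  sumMap (λ a → sumMap (λ b → sumMap (λ w → h (b ∷ w ∷ʳ a)) (words n L)) (letters n)) (letters n)
    ≡⟨ sumMap-cong (λ a → sym (sumMap-words-head n L (λ v → h (v ∷ʳ a)))) (letters n) ⟩
  sumMap (λ a → sumMap (λ v → h (v ∷ʳ a)) (words n (suc L))) (letters n) ∎
  where open ≡-Reasoning

𝟙-∷-≟ʷ : ∀ a b w v → 𝟙 (a ∷ w ≟ʷ b ∷ v) ≡ 𝟙 (a ≟ b) * 𝟙 (w ≟ʷ v)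
𝟙-∷-≟ʷ a b w v = trans (𝟙-cong (a ∷ w ≟ʷ b ∷ v) ((a ≟ b) ×-dec (w ≟ʷ v)) LP.∷-injective λ { (refl , refl) → refl })
  (𝟙-× (a ≟ b) (w ≟ʷ v))

sumMap-words-≟ʷ : ∀ n L {t} → IsWordOver n L t → sumMap (λ u → 𝟙 (u ≟ʷ t)) (words n L) ≡ 1
sumMap-words-≟ʷ n zero {[]} _ = refl
sumMap-words-≟ʷ n (suc L) {c ∷ t} (|ct|≡L+1 , c∈ ∷ t∈) = begin
  sumMap (λ u → 𝟙 (u ≟ʷ c ∷ t)) (words n (suc L))
    ≡⟨ sumMap-words-head n L _ ⟩
  sumMap (λ a → sumMap (λ w → 𝟙 (a ∷ w ≟ʷ c ∷ t)) (words n L)) (letters n)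
    ≡⟨ sumMap-cong (λ a → trans (sumMap-cong (λ w → 𝟙-∷-≟ʷ a c w t) (words n L))
                                (sumMap-*ˡ (𝟙 (a ≟ c)) _ (words n L))) (letters n) ⟩
  sumMap (λ a → 𝟙 (a ≟ c) * sumMap (λ w → 𝟙 (w ≟ʷ t)) (words n L)) (letters n)
    ≡⟨ sumMap-letters-pickLetter n (λ _ → sumMap (λ w → 𝟙 (w ≟ʷ t)) (words n L)) c∈ ⟩
  sumMap (λ w → 𝟙 (w ≟ʷ t)) (words n L)
    ≡⟨ sumMap-words-≟ʷ n L (suc-injective |ct|≡L+1 , t∈) ⟩
  1 ∎
  where open ≡-Reasoning

braidable? : (a b c : ℕ) → Dec (c ≡ a × (b ≡ suc a ⊎ a ≡ suc b))
braidable? a b c = (c ≟ a) ×-dec ((b ≟ suc a) ⊎-dec (a ≟ suc b))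

length-moveHead : ∀ a b c w → length (moveHead (a ∷ b ∷ c ∷ w)) ≡ 𝟙 (braidable? a b c)
length-moveHead a b c w with braidable? a b c
... | yes _ = refl
... | no _ = refl

𝟙-braidable : ∀ a b c → 𝟙 (braidable? a b c) ≡ 𝟙 (c ≟ a) * (𝟙 (b ≟ suc a) + 𝟙 (a ≟ suc b))
𝟙-braidable a b c = trans (𝟙-× (c ≟ a) _)
  (cong (𝟙 (c ≟ a) *_) (𝟙-⊎ (b ≟ suc a) (a ≟ suc b) λ { (refl , a≡a+2) → n≢2+n a a≡a+2 }))

-- The number of braid moves of w ∷ʳ a that involve the final letter a.
braidsAtEnd : Word → ℕ → ℕ
braidsAtEnd (x ∷ y ∷ []) a = 𝟙 (braidable? x y a)
braidsAtEnd (x ∷ y ∷ z ∷ w) a = braidsAtEnd (y ∷ z ∷ w) a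
braidsAtEnd _ a = 0

length-braidNeighbours-∷ : ∀ a w → length (braidNeighbours (a ∷ w)) ≡ length (moveHead (a ∷ w)) + length (braidNeighbours w)
length-braidNeighbours-∷ a w =
  trans (LP.length-++ (moveHead (a ∷ w))) (cong (length (moveHead (a ∷ w)) +_) (LP.length-map (a ∷_) (braidNeighbours w)))

length-braidNeighbours-∷ʳ : ∀ w a → length (braidNeighbours (w ∷ʳ a)) ≡ length (braidNeighbours w) + braidsAtEnd w a
length-braidNeighbours-∷ʳ [] a = refl
length-braidNeighbours-∷ʳ (x ∷ []) a = refl
length-braidNeighbours-∷ʳ (x ∷ y ∷ []) a = trans (length-braidNeighbours-∷ x (y ∷ a ∷ []))
  (trans (cong (_+ 0) (length-moveHead x y a [])) (+-identityʳ _))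
length-braidNeighbours-∷ʳ (x ∷ y ∷ z ∷ w) a = begin
  length (braidNeighbours (x ∷ y ∷ z ∷ w ∷ʳ a))
    ≡⟨ length-braidNeighbours-∷ x (y ∷ z ∷ w ∷ʳ a) ⟩
  length (moveHead (x ∷ y ∷ z ∷ w ∷ʳ a)) + length (braidNeighbours (y ∷ z ∷ w ∷ʳ a))
    ≡⟨ cong₂ _+_ (trans (length-moveHead x y z (w ∷ʳ a)) (sym (length-moveHead x y z w)))
                 (length-braidNeighbours-∷ʳ (y ∷ z ∷ w) a) ⟩
  length (moveHead (x ∷ y ∷ z ∷ w)) + (length (braidNeighbours (y ∷ z ∷ w)) + braidsAtEnd (y ∷ z ∷ w) a)
    ≡⟨ +-assoc (length (moveHead (x ∷ y ∷ z ∷ w))) _ _ ⟨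
  length (moveHead (x ∷ y ∷ z ∷ w)) + length (braidNeighbours (y ∷ z ∷ w)) + braidsAtEnd (y ∷ z ∷ w) a
    ≡⟨ cong (_+ braidsAtEnd (y ∷ z ∷ w) a) (length-braidNeighbours-∷ x (y ∷ z ∷ w)) ⟨
  length (braidNeighbours (x ∷ y ∷ z ∷ w)) + braidsAtEnd (x ∷ y ∷ z ∷ w) a ∎
  where open ≡-Reasoning

braidsAtEnd-∷ʳ∷ʳ : ∀ p x y a → braidsAtEnd (p ∷ʳ x ∷ʳ y) a ≡ 𝟙 (braidable? x y a)
braidsAtEnd-∷ʳ∷ʳ [] x y a = refl
braidsAtEnd-∷ʳ∷ʳ (q ∷ []) x y a = refl
braidsAtEnd-∷ʳ∷ʳ (q ∷ r ∷ []) x y a = refl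
braidsAtEnd-∷ʳ∷ʳ (q ∷ r ∷ s ∷ p) x y a = braidsAtEnd-∷ʳ∷ʳ (r ∷ s ∷ p) x y a

moveHead-changesHead : ∀ a w {u} → u ∈ moveHead (a ∷ w) → Σ ℕ λ b → Σ Word λ u′ → u ≡ b ∷ u′ × b ≢ a
moveHead-changesHead a (b ∷ c ∷ w) u∈ with braidable? a b c
moveHead-changesHead a (.(suc a) ∷ .a ∷ w) (here refl) | yes (refl , inj₁ refl) = suc a , _ , refl , 1+n≢n
moveHead-changesHead .(suc b) (b ∷ .(suc b) ∷ w) (here refl) | yes (refl , inj₂ refl) = b , _ , refl , 1+n≢n ∘ sym
moveHead-changesHead a (b ∷ c ∷ w) (there ()) | yes _

moveHead-eval : ∀ {n} v → All (IsLetter n) v → ∀ {u} → u ∈ moveHead v → ∀ (x : Fin n) → eval u x ≡ eval v x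
moveHead-eval (a ∷ b ∷ c ∷ w) _ u∈ x with braidable? a b c
moveHead-eval (.(suc j) ∷ .(suc (suc j)) ∷ .(suc j) ∷ w) ((j , refl , _) ∷ b∈ ∷ _) (here refl) x
  | yes (refl , inj₁ refl) = sym (swapAdj-braid j (eval w x) (isLetter⇒< b∈))
moveHead-eval (.(suc (suc k)) ∷ .(suc k) ∷ .(suc (suc k)) ∷ w) (a∈ ∷ (k , refl , _) ∷ _) (here refl) x
  | yes (refl , inj₂ refl) = swapAdj-braid k (eval w x) (isLetter⇒< a∈)
moveHead-eval (a ∷ b ∷ c ∷ w) _ (there ()) x | yes _

braidNeighbours-eval : ∀ {n} v → All (IsLetter n) v → ∀ {u} → u ∈ braidNeighbours v → ∀ (x : Fin n) → eval u x ≡ eval v x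
braidNeighbours-eval (a ∷ w) v∈@(_ ∷ w∈) u∈ x with ∈-++⁻ (moveHead (a ∷ w)) u∈
... | inj₁ u∈moveHead = moveHead-eval (a ∷ w) v∈ u∈moveHead x
... | inj₂ u∈rest with ∈-map⁻ (a ∷_) u∈rest
...   | u′ , u′∈ , refl = cong (s a) (braidNeighbours-eval w w∈ u′∈ x)

𝟙-∈-++ : ∀ u xs ys → ¬ (u ∈ xs × u ∈ ys) → 𝟙 (u ∈? xs ++ ys) ≡ 𝟙 (u ∈? xs) + 𝟙 (u ∈? ys)
𝟙-∈-++ u xs ys disjoint = trans
  (𝟙-cong (u ∈? xs ++ ys) ((u ∈? xs) ⊎-dec (u ∈? ys))
    (∈-++⁻ xs) λ { (inj₁ p) → ∈-++⁺ˡ p ; (inj₂ q) → ∈-++⁺ʳ xs q })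
  (𝟙-⊎ (u ∈? xs) (u ∈? ys) disjoint)

𝟙-∈-map-∷ : ∀ c w a zs → 𝟙 (c ∷ w ∈? map (a ∷_) zs) ≡ 𝟙 (c ≟ a) * 𝟙 (w ∈? zs)
𝟙-∈-map-∷ c w a zs = trans
  (𝟙-cong (c ∷ w ∈? map (a ∷_) zs) ((c ≟ a) ×-dec (w ∈? zs))
    (λ p → let (w′ , w′∈ , e) = ∈-map⁻ (a ∷_) p in LP.∷-injectiveˡ e , subst (_∈ zs) (sym (LP.∷-injectiveʳ e)) w′∈)
    λ { (refl , q) → ∈-map⁺ (a ∷_) q })
  (𝟙-× (c ≟ a) (w ∈? zs))

module _ (n : ℕ) where

  countWords-moveHead : ∀ v → All (IsLetter n) v → sumMap (λ u → 𝟙 (u ∈? moveHead v)) (words n (length v)) ≡ length (moveHead v)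
  countWords-moveHead [] _ = sumMap-zeroᴬ (All.universal (λ _ → refl) (words n 0))
  countWords-moveHead (a ∷ []) _ = sumMap-zeroᴬ (All.universal (λ _ → refl) (words n 1))
  countWords-moveHead (a ∷ b ∷ []) _ = sumMap-zeroᴬ (All.universal (λ _ → refl) (words n 2))
  countWords-moveHead (a ∷ b ∷ c ∷ w) (a∈ ∷ b∈ ∷ _ ∷ w∈) with braidable? a b c
  ... | no _ = sumMap-zeroᴬ (All.universal (λ _ → refl) (words n (length (a ∷ b ∷ c ∷ w))))
  ... | yes (refl , _) = trans
    (sumMap-cong (λ u → 𝟙-cong (u ∈? (b ∷ a ∷ b ∷ w) ∷ []) (u ≟ʷ b ∷ a ∷ b ∷ w) (λ { (here e) → e }) here)
                 (words n (3 + length w)))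
    (sumMap-words-≟ʷ n (3 + length w) (refl , b∈ ∷ a∈ ∷ b∈ ∷ w∈))

  countWords-∈-map-∷ : ∀ L {a} → IsLetter n a → ∀ zs →
    sumMap (λ u → 𝟙 (u ∈? map (a ∷_) zs)) (words n (suc L)) ≡ sumMap (λ w → 𝟙 (w ∈? zs)) (words n L)
  countWords-∈-map-∷ L {a} a∈ zs = begin
    sumMap (λ u → 𝟙 (u ∈? map (a ∷_) zs)) (words n (suc L))
      ≡⟨ sumMap-words-head n L _ ⟩
    sumMap (λ c → sumMap (λ w → 𝟙 (c ∷ w ∈? map (a ∷_) zs)) (words n L)) (letters n)
      ≡⟨ sumMap-cong (λ c → trans (sumMap-cong (λ w → 𝟙-∈-map-∷ c w a zs) (words n L))
           (sumMap-*ˡ (𝟙 (c ≟ a)) _ (words n L))) (letters n) ⟩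
    sumMap (λ c → 𝟙 (c ≟ a) * sumMap (λ w → 𝟙 (w ∈? zs)) (words n L)) (letters n)
      ≡⟨ sumMap-letters-pickLetter n _ a∈ ⟩
    sumMap (λ w → 𝟙 (w ∈? zs)) (words n L) ∎
    where open ≡-Reasoning

  countWords-braidNeighbours : ∀ v → All (IsLetter n) v →
    sumMap (λ u → 𝟙 (u ∈? braidNeighbours v)) (words n (length v)) ≡ length (braidNeighbours v)
  countWords-braidNeighbours [] _ = refl
  countWords-braidNeighbours (a ∷ w) (a∈ ∷ w∈) = begin
    sumMap (λ u → 𝟙 (u ∈? braidNeighbours (a ∷ w))) W
      ≡⟨ sumMap-cong (λ u → 𝟙-∈-++ u (moveHead (a ∷ w)) rest (disjoint u)) W ⟩
    sumMap (λ u → 𝟙 (u ∈? moveHead (a ∷ w)) + 𝟙 (u ∈? rest)) W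
      ≡⟨ sumMap-+ (λ u → 𝟙 (u ∈? moveHead (a ∷ w))) (λ u → 𝟙 (u ∈? rest)) W ⟩
    sumMap (λ u → 𝟙 (u ∈? moveHead (a ∷ w))) W + sumMap (λ u → 𝟙 (u ∈? rest)) W
      ≡⟨ cong₂ _+_ (countWords-moveHead (a ∷ w) (a∈ ∷ w∈)) countRest ⟩
    length (moveHead (a ∷ w)) + length (braidNeighbours w)
      ≡⟨ length-braidNeighbours-∷ a w ⟨
    length (braidNeighbours (a ∷ w)) ∎
    where
    open ≡-Reasoning
    rest = map (a ∷_) (braidNeighbours w)
    W = words n (suc (length w))
    disjoint : ∀ u → ¬ (u ∈ moveHead (a ∷ w) × u ∈ rest)
    disjoint u (p , q) with moveHead-changesHead a w p | ∈-map⁻ (a ∷_) q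
    ... | b , _ , refl , b≢a | _ , _ , e = b≢a (LP.∷-injectiveˡ e)
    countRest : sumMap (λ u → 𝟙 (u ∈? rest)) W ≡ length (braidNeighbours w)
    countRest = trans (countWords-∈-map-∷ (length w) a∈ (braidNeighbours w)) (countWords-braidNeighbours w w∈)

braidsAtEnd-short : ∀ w a → length w ≤ 1 → braidsAtEnd w a ≡ 0
braidsAtEnd-short [] a _ = refl
braidsAtEnd-short (x ∷ []) a _ = refl
braidsAtEnd-short (x ∷ y ∷ w) a (s≤s ())

eval-∷ʳ : ∀ {n} w a (x : Fin n) → eval (w ∷ʳ a) x ≡ eval w (s a x)
eval-∷ʳ [] a x = refl
eval-∷ʳ (b ∷ w) a x = cong (s b) (eval-∷ʳ w a x)

module _ {n : ℕ} where

  wordOf : (Fin n → Fin n) → Word → ℕ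
  wordOf g w = 𝟙 (isWordOf? g w)

  wordOf-∷ʳ : ∀ (g : Fin n → Fin n) w a → wordOf g (w ∷ʳ a) ≡ wordOf (g ·s a) w
  wordOf-∷ʳ g w a = 𝟙-cong (isWordOf? g (w ∷ʳ a)) (isWordOf? (g ·s a) w)
    (λ g≗ x → trans (g≗ (s a x)) (trans (eval-∷ʳ w a (s a x)) (cong (eval w) (swapAdj-involutive (a ∸ 1) x))))
    (λ g·s≗ x → trans (cong g (sym (swapAdj-involutive (a ∸ 1) x))) (trans (g·s≗ (s a x)) (sym (eval-∷ʳ w a x))))

  wordOf-cong : {g h : Fin n → Fin n} → (∀ x → g x ≡ h x) → ∀ w → wordOf g w ≡ wordOf h w
  wordOf-cong g≗h w = 𝟙-cong (isWordOf? _ w) (isWordOf? _ w) (λ p x → trans (sym (g≗h x)) (p x)) (λ p x → trans (g≗h x) (p x))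

  wordOf-short : ∀ (g : Fin n → Fin n) {w} → length w < ℓ g → wordOf g w ≡ 0
  wordOf-short g {w} |w|<ℓ = 𝟙-no (isWordOf? g w) λ g≗w → <⇒≱ |w|<ℓ (ℓ-≤-length {g = g} {w = w} g≗w)

  wordCount : (Fin n → Fin n) → ℕ → ℕ
  wordCount g M = sumMap (wordOf g) (words n M)

  wordCount-short : ∀ (g : Fin n → Fin n) M → M < ℓ g → wordCount g M ≡ 0
  wordCount-short g M M<ℓ = sumMap-zeroᴬ (All.map (λ { {w} (refl , _) → wordOf-short g {w} M<ℓ }) (words-isWordOver n M))

  wordCount-ℓ : ∀ (g : Fin n → Fin n) M → ℓ g ≡ M → wordCount g M ≡ length (𝓡 g)
  wordCount-ℓ g M refl = sym (length-filter (isWordOf? g) (words n (ℓ g)))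

  wordCount-cong : {g h : Fin n → Fin n} → (∀ x → g x ≡ h x) → ∀ M → wordCount g M ≡ wordCount h M
  wordCount-cong g≗h M = sumMap-cong (wordOf-cong g≗h) (words n M)

  d𝓑-reduced : ∀ (g : Fin n → Fin n) {v} → IsWordOf g v → IsWordOver n (ℓ g) v → d𝓑 g v ≡ length (braidNeighbours v)
  d𝓑-reduced g {v} g≗v (|v|≡ℓ , v∈) = begin
    length (filter (λ u → u ∈? braidNeighbours v) (𝓡 g))
      ≡⟨ length-filter (λ u → u ∈? braidNeighbours v) (𝓡 g) ⟩
    sumMap (λ u → 𝟙 (u ∈? braidNeighbours v)) (𝓡 g)
      ≡⟨ sumMap-filter (isWordOf? g) _ (words n (ℓ g)) ⟩
    sumMap (λ u → wordOf g u * 𝟙 (u ∈? braidNeighbours v)) (words n (ℓ g))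
      ≡⟨ sumMap-cong neighboursAreReduced (words n (ℓ g)) ⟩
    sumMap (λ u → 𝟙 (u ∈? braidNeighbours v)) (words n (ℓ g))
      ≡⟨ cong (λ L → sumMap (λ u → 𝟙 (u ∈? braidNeighbours v)) (words n L)) |v|≡ℓ ⟨
    sumMap (λ u → 𝟙 (u ∈? braidNeighbours v)) (words n (length v))
      ≡⟨ countWords-braidNeighbours n v v∈ ⟩
    length (braidNeighbours v) ∎
    where
    open ≡-Reasoning
    neighboursAreReduced : ∀ u → wordOf g u * 𝟙 (u ∈? braidNeighbours v) ≡ 𝟙 (u ∈? braidNeighbours v)
    neighboursAreReduced u with u ∈? braidNeighbours v
    ... | no _ = *-zeroʳ (wordOf g u)
    ... | yes u∈ = cong (_* 1) (𝟙-yes (isWordOf? g u) λ x → trans (g≗v x) (sym (braidNeighbours-eval v v∈ u∈ x)))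

  braidDegreeSum : (Fin n → Fin n) → ℕ → ℕ
  braidDegreeSum g L = sumMap (λ v → wordOf g v * length (braidNeighbours v)) (words n L)

  totalBraidDegree-braidDegreeSum : ∀ (g : Fin n → Fin n) → totalBraidDegree g ≡ braidDegreeSum g (ℓ g)
  totalBraidDegree-braidDegreeSum g = trans (sumMap-filter (isWordOf? g) (d𝓑 g) (words n (ℓ g)))
    (sumMap-congᴬ (All.map degree (words-isWordOver n (ℓ g))))
    where
    degree : ∀ {v} → IsWordOver n (ℓ g) v → wordOf g v * d𝓑 g v ≡ wordOf g v * length (braidNeighbours v)
    degree {v} v∈ with isWordOf? g v
    ... | yes g≗v = cong (1 *_) (d𝓑-reduced g g≗v v∈)
    ... | no _ = refl

  braidDegreeSum-short : ∀ (g : Fin n → Fin n) L → L < ℓ g → braidDegreeSum g L ≡ 0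
  braidDegreeSum-short g L L<ℓ = sumMap-zeroᴬ (All.map
    (λ { {v} (refl , _) → cong (_* length (braidNeighbours v)) (wordOf-short g {v} L<ℓ) }) (words-isWordOver n L))


module _ {n : ℕ} (f : Fin n → Fin n) where

  isDescent⇒isLetter : ∀ {i} → IsDescent f i → IsLetter n i
  isDescent⇒isLetter {zero} d = ⊥-elim (¬isDescent-0 f d)
  isDescent⇒isLetter {suc j} d = j , refl , 1+m<n⇒m<n∸1 (isDescent⇒< f d)

  doubleDescentTerm : ℕ → ℕ
  doubleDescentTerm i = 𝟙 (isDescent? f i ×-dec isDescent? f (suc i)) * length (𝓡 (braidTriple f i))

  doubleDescentTerm-zero : ∀ {i} → ¬ (IsDescent f i × IsDescent f (suc i)) → doubleDescentTerm i ≡ 0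
  doubleDescentTerm-zero {i} ¬dd = cong (_* length (𝓡 (braidTriple f i))) (𝟙-no (isDescent? f i ×-dec isDescent? f (suc i)) ¬dd)

  doubleDescentTerm-short : ∀ i → ℓ f ≤ 2 → doubleDescentTerm i ≡ 0
  doubleDescentTerm-short i ℓ≤2 = doubleDescentTerm-zero λ (d₁ , d₂) →
    <⇒≱ (s≤s ℓ≤2) (≤-trans (m≤m+n 3 _) (≤-reflexive (ℓ-braidTriple-doubleDescent f i d₁ d₂)))

  wordCount-braidTriple : ∀ M j → ℓ f ≡ 3 + M → wordCount (braidTriple f (suc j)) M ≡ doubleDescentTerm (suc j)
  wordCount-braidTriple M j ℓ≡ with isDescent? f (suc j) ×-dec isDescent? f (suc (suc j))
  ... | yes (d₁ , d₂) = trans (wordCount-ℓ _ M (+-cancelˡ-≡ 3 _ _ (trans (ℓ-braidTriple-doubleDescent f (suc j) d₁ d₂) ℓ≡)))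
                              (sym (+-identityʳ _))
  ... | no ¬dd = wordCount-short _ M (s≤s⁻¹ (s≤s⁻¹ (≤-trans (≤-reflexive (sym ℓ≡)) (ℓ-≤-braidTriple f j ¬dd))))

  endBraidDegreeSum : ℕ → ℕ → ℕ
  endBraidDegreeSum a L = sumMap (λ w → wordOf (f ·s a) w * braidsAtEnd w a) (words n L)

  endBraidDegreeSum-short : ∀ L a → ℓ f ≡ suc L → L ≤ 1 →
    endBraidDegreeSum a L ≡ doubleDescentTerm a + doubleDescentTerm (a ∸ 1)
  endBraidDegreeSum-short L a ℓ≡ L≤1 = begin
    endBraidDegreeSum a L
      ≡⟨ sumMap-zeroᴬ (All.map noBraidAtEnd (words-isWordOver n L)) ⟩
    0
      ≡⟨ cong₂ _+_ (doubleDescentTerm-short a ℓ≤2) (doubleDescentTerm-short (a ∸ 1) ℓ≤2) ⟨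
    doubleDescentTerm a + doubleDescentTerm (a ∸ 1) ∎
    where
    open ≡-Reasoning
    ℓ≤2 : ℓ f ≤ 2
    ℓ≤2 = ≤-trans (≤-reflexive ℓ≡) (s≤s L≤1)
    noBraidAtEnd : ∀ {w} → IsWordOver n L w → wordOf (f ·s a) w * braidsAtEnd w a ≡ 0
    noBraidAtEnd {w} (refl , _) = trans (cong (wordOf (f ·s a) w *_) (braidsAtEnd-short w a L≤1)) (*-zeroʳ (wordOf (f ·s a) w))

  endBraidDegreeSum-byLastTwo : ∀ a M → IsLetter n a → endBraidDegreeSum a (2 + M)
    ≡ sumMap (λ y → (𝟙 (y ≟ suc a) + 𝟙 (a ≟ suc y)) * wordCount (((f ·s a) ·s y) ·s a) M) (letters n)
  endBraidDegreeSum-byLastTwo a M a∈ = begin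
    endBraidDegreeSum a (2 + M)
      ≡⟨ sumMap-words-last n (suc M) H ⟩
    sumMap (λ y → sumMap (λ v → H (v ∷ʳ y)) (words n (suc M))) (letters n)
      ≡⟨ sumMap-cong (λ y → sumMap-words-last n M (λ v → H (v ∷ʳ y))) (letters n) ⟩
    sumMap (λ y → sumMap (λ x → sumMap (λ p → H (p ∷ʳ x ∷ʳ y)) (words n M)) (letters n)) (letters n)
      ≡⟨ sumMap-cong (λ y → sumMap-cong (λ x → trans (sumMap-cong (lastTwo y x) (words n M))
           (sumMap-*ʳ (𝟙 (braidable? x y a)) (wordOf (((f ·s a) ·s y) ·s x)) (words n M))) (letters n)) (letters n) ⟩
    sumMap (λ y → sumMap (λ x → wordCount (((f ·s a) ·s y) ·s x) M * 𝟙 (braidable? x y a)) (letters n)) (letters n)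
      ≡⟨ sumMap-cong (λ y → trans (sumMap-cong (rearrange y) (letters n))
           (sumMap-letters-pickLetter n (λ x → (𝟙 (y ≟ suc x) + 𝟙 (x ≟ suc y)) * wordCount (((f ·s a) ·s y) ·s x) M) a∈))
           (letters n) ⟩
    sumMap (λ y → (𝟙 (y ≟ suc a) + 𝟙 (a ≟ suc y)) * wordCount (((f ·s a) ·s y) ·s a) M) (letters n) ∎
    where
    open ≡-Reasoning
    H : Word → ℕ
    H w = wordOf (f ·s a) w * braidsAtEnd w a
    lastTwo : ∀ y x p → H (p ∷ʳ x ∷ʳ y) ≡ wordOf (((f ·s a) ·s y) ·s x) p * 𝟙 (braidable? x y a)
    lastTwo y x p = cong₂ _*_ (trans (wordOf-∷ʳ (f ·s a) (p ∷ʳ x) y) (wordOf-∷ʳ ((f ·s a) ·s y) p x))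
                              (braidsAtEnd-∷ʳ∷ʳ p x y a)
    rearrange : ∀ y x → wordCount (((f ·s a) ·s y) ·s x) M * 𝟙 (braidable? x y a)
                      ≡ 𝟙 (x ≟ a) * ((𝟙 (y ≟ suc x) + 𝟙 (x ≟ suc y)) * wordCount (((f ·s a) ·s y) ·s x) M)
    rearrange y x = begin
      C * 𝟙 (braidable? x y a)                  ≡⟨ cong (C *_) (𝟙-braidable x y a) ⟩
      C * (𝟙 (a ≟ x) * R)                       ≡⟨ *-comm C _ ⟩
      𝟙 (a ≟ x) * R * C                         ≡⟨ *-assoc (𝟙 (a ≟ x)) R C ⟩
      𝟙 (a ≟ x) * (R * C)                       ≡⟨ cong (_* (R * C)) (𝟙-cong (a ≟ x) (x ≟ a) sym sym) ⟩
      𝟙 (x ≟ a) * (R * C)                       ∎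
      where
      C = wordCount (((f ·s a) ·s y) ·s x) M
      R = 𝟙 (y ≟ suc x) + 𝟙 (x ≟ suc y)

  endBraidDegreeSum-doubleDescents : ∀ M j → ℓ f ≡ 3 + M → IsLetter n (suc j) →
    endBraidDegreeSum (suc j) (2 + M) ≡ doubleDescentTerm (suc j) + doubleDescentTerm j
  endBraidDegreeSum-doubleDescents M j ℓ≡ a∈ = begin
    endBraidDegreeSum a (2 + M)
      ≡⟨ endBraidDegreeSum-byLastTwo a M a∈ ⟩
    sumMap (λ y → (𝟙 (y ≟ suc a) + 𝟙 (a ≟ suc y)) * C y) (letters n)
      ≡⟨ sumMap-cong (λ y → *-distribʳ-+ (C y) (𝟙 (y ≟ suc a)) (𝟙 (a ≟ suc y))) (letters n) ⟩
    sumMap (λ y → 𝟙 (y ≟ suc a) * C y + 𝟙 (a ≟ suc y) * C y) (letters n)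
      ≡⟨ sumMap-+ (λ y → 𝟙 (y ≟ suc a) * C y) (λ y → 𝟙 (a ≟ suc y) * C y) (letters n) ⟩
    sumMap (λ y → 𝟙 (y ≟ suc a) * C y) (letters n) + sumMap (λ y → 𝟙 (a ≟ suc y) * C y) (letters n)
      ≡⟨ cong (sumMap (λ y → 𝟙 (y ≟ suc a) * C y) (letters n) +_)
           (sumMap-cong (λ y → cong (_* C y) (𝟙-cong (a ≟ suc y) (y ≟ j) (sym ∘ suc-injective) (cong suc ∘ sym))) (letters n)) ⟩
    sumMap (λ y → 𝟙 (y ≟ suc a) * C y) (letters n) + sumMap (λ y → 𝟙 (y ≟ j) * C y) (letters n)
      ≡⟨ cong₂ _+_ (sumMap-letters-pick n C (suc a)) (sumMap-letters-pick n C j) ⟩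
    𝟙 (isLetter? n (suc a)) * C (suc a) + 𝟙 (isLetter? n j) * C j
      ≡⟨ cong₂ _+_ (𝟙-*-≡ (isLetter? n (suc a)) (λ _ → wordCount-braidTriple M j ℓ≡)
                           (λ ¬a+1∈ → doubleDescentTerm-zero λ (_ , d₂) → ¬a+1∈ (isDescent⇒isLetter d₂)))
                   (𝟙-*-≡ (isLetter? n j) below
                           (λ ¬j∈ → doubleDescentTerm-zero λ (d₁ , _) → ¬j∈ (isDescent⇒isLetter d₁))) ⟩
    doubleDescentTerm a + doubleDescentTerm j ∎
    where
    open ≡-Reasoning
    a = suc j
    C : ℕ → ℕ
    C y = wordCount (((f ·s a) ·s y) ·s a) M
    below : IsLetter n j → C j ≡ doubleDescentTerm j
    below (j′ , refl , _) = trans (wordCount-cong (λ x → cong f (sym (swapAdj-braid j′ x (isLetter⇒< a∈)))) M)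
                                  (wordCount-braidTriple M j′ ℓ≡)

  endBraidDegreeSum-letter : ∀ L a → ℓ f ≡ suc L → IsLetter n a →
    endBraidDegreeSum a L ≡ doubleDescentTerm a + doubleDescentTerm (a ∸ 1)
  endBraidDegreeSum-letter zero a ℓ≡ _ = endBraidDegreeSum-short zero a ℓ≡ z≤n
  endBraidDegreeSum-letter (suc zero) a ℓ≡ _ = endBraidDegreeSum-short 1 a ℓ≡ (s≤s z≤n)
  endBraidDegreeSum-letter (suc (suc M)) (suc j) ℓ≡ a∈ = endBraidDegreeSum-doubleDescents M j ℓ≡ a∈
  endBraidDegreeSum-letter (suc (suc M)) zero _ (_ , () , _)

  braidDegreeSum-·s : ∀ L a → ℓ f ≡ suc L → IsLetter n a →
    braidDegreeSum (f ·s a) L ≡ 𝟙 (isDescent? f a) * totalBraidDegree (f ·s a)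
  braidDegreeSum-·s L .(suc j) ℓ≡ (j , refl , _) = sym (𝟙-*-≡ (isDescent? f (suc j)) descent ascent)
    where
    descent : IsDescent f (suc j) → totalBraidDegree (f ·s suc j) ≡ braidDegreeSum (f ·s suc j) L
    descent d = trans (totalBraidDegree-braidDegreeSum (f ·s suc j))
      (cong (braidDegreeSum (f ·s suc j)) (suc-injective (trans (ℓ-·s-descent f (suc j) d) ℓ≡)))
    ascent : ¬ IsDescent f (suc j) → braidDegreeSum (f ·s suc j) L ≡ 0
    ascent ¬d = braidDegreeSum-short (f ·s suc j) L (≤-trans (≤-reflexive (sym ℓ≡)) (ℓ-·s-ascent f j ¬d))

  braidDegreeSum-byLastLetter : ∀ L → braidDegreeSum f (suc L)
    ≡ sumMap (λ a → braidDegreeSum (f ·s a) L) (letters n) + sumMap (λ a → endBraidDegreeSum a L) (letters n)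
  braidDegreeSum-byLastLetter L = begin
    braidDegreeSum f (suc L)
      ≡⟨ sumMap-words-last n L (λ v → wordOf f v * length (braidNeighbours v)) ⟩
    sumMap (λ a → sumMap (λ w → wordOf f (w ∷ʳ a) * length (braidNeighbours (w ∷ʳ a))) (words n L)) (letters n)
      ≡⟨ sumMap-cong (λ a → trans (sumMap-cong (lastLetter a) (words n L)) (sumMap-+ _ _ (words n L))) (letters n) ⟩
    sumMap (λ a → braidDegreeSum (f ·s a) L + endBraidDegreeSum a L) (letters n)
      ≡⟨ sumMap-+ (λ a → braidDegreeSum (f ·s a) L) (λ a → endBraidDegreeSum a L) (letters n) ⟩
    sumMap (λ a → braidDegreeSum (f ·s a) L) (letters n) + sumMap (λ a → endBraidDegreeSum a L) (letters n) ∎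
    where
    open ≡-Reasoning
    lastLetter : ∀ a w → wordOf f (w ∷ʳ a) * length (braidNeighbours (w ∷ʳ a))
                       ≡ wordOf (f ·s a) w * length (braidNeighbours w) + wordOf (f ·s a) w * braidsAtEnd w a
    lastLetter a w = trans (cong₂ _*_ (wordOf-∷ʳ f w a) (length-braidNeighbours-∷ʳ w a)) (*-distribˡ-+ (wordOf (f ·s a) w) _ _)

  sumMap-doubleDescentTerm-shift : sumMap (λ a → doubleDescentTerm (a ∸ 1)) (letters n) ≡ sumMap doubleDescentTerm (letters n)
  sumMap-doubleDescentTerm-shift = begin
    sumMap (λ a → doubleDescentTerm (a ∸ 1)) (letters n)
      ≡⟨ sumMap-letters n _ ⟩
    sumMap DD (upTo (n ∸ 1))
      ≡⟨ +-identityʳ _ ⟨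
    sumMap DD (upTo (n ∸ 1)) + 0
      ≡⟨ cong (sumMap DD (upTo (n ∸ 1)) +_) lastVanishes ⟨
    sumMap DD (upTo (n ∸ 1)) + DD (n ∸ 1)
      ≡⟨ sumMap-upTo-shift DD (n ∸ 1) ⟩
    DD 0 + sumMap (DD ∘ suc) (upTo (n ∸ 1))
      ≡⟨ cong (_+ sumMap (DD ∘ suc) (upTo (n ∸ 1))) firstVanishes ⟩
    sumMap (DD ∘ suc) (upTo (n ∸ 1))
      ≡⟨ sumMap-letters n DD ⟨
    sumMap DD (letters n) ∎
    where
    open ≡-Reasoning
    DD = doubleDescentTerm
    firstVanishes : doubleDescentTerm 0 ≡ 0
    firstVanishes = doubleDescentTerm-zero λ (d₀ , _) → ¬isDescent-0 f d₀
    lastVanishes : doubleDescentTerm (n ∸ 1) ≡ 0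
    lastVanishes = doubleDescentTerm-zero λ (_ , d) → <-irrefl refl (1+m<n⇒m<n∸1 (isDescent⇒< f d))

  descentSum doubleDescentSum : ℕ
  descentSum = sumMap (λ a → 𝟙 (isDescent? f a) * totalBraidDegree (f ·s a)) (letters n)
  doubleDescentSum = sumMap doubleDescentTerm (letters n)

  braidDegreeSum-ℓ : ∀ L → ℓ f ≡ L → braidDegreeSum f L ≡ descentSum + 2 * doubleDescentSum
  braidDegreeSum-ℓ zero ℓ≡0 = begin
    braidDegreeSum f 0                   ≡⟨ cong (_+ 0) (*-zeroʳ (wordOf f [])) ⟩
    0                                    ≡⟨ cong₂ (λ x y → x + 2 * y) noDescents noDoubleDescents ⟨
    descentSum + 2 * doubleDescentSum    ∎
    where
    open ≡-Reasoning
    noDescents : descentSum ≡ 0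
    noDescents = sumMap-zeroᴬ (All.universal (λ a → cong (_* totalBraidDegree (f ·s a))
      (𝟙-no (isDescent? f a) λ d → 0≢1+n (trans (sym ℓ≡0) (sym (ℓ-·s-descent f a d))))) (letters n))
    noDoubleDescents : doubleDescentSum ≡ 0
    noDoubleDescents = sumMap-zeroᴬ (All.universal (λ i → doubleDescentTerm-short i (≤-trans (≤-reflexive ℓ≡0) z≤n)) (letters n))
  braidDegreeSum-ℓ (suc L) ℓ≡ = begin
    braidDegreeSum f (suc L)
      ≡⟨ braidDegreeSum-byLastLetter L ⟩
    sumMap (λ a → braidDegreeSum (f ·s a) L) (letters n) + sumMap (λ a → endBraidDegreeSum a L) (letters n)
      ≡⟨ cong₂ _+_ (sumMap-congᴬ (All.map (braidDegreeSum-·s L _ ℓ≡) (letters-isLetter n)))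
                   (sumMap-congᴬ (All.map (endBraidDegreeSum-letter L _ ℓ≡) (letters-isLetter n))) ⟩
    descentSum + sumMap (λ a → doubleDescentTerm a + doubleDescentTerm (a ∸ 1)) (letters n)
      ≡⟨ cong (descentSum +_) (sumMap-+ doubleDescentTerm (λ a → doubleDescentTerm (a ∸ 1)) (letters n)) ⟩
    descentSum + (doubleDescentSum + sumMap (λ a → doubleDescentTerm (a ∸ 1)) (letters n))
      ≡⟨ cong (λ x → descentSum + (doubleDescentSum + x)) (trans sumMap-doubleDescentTerm-shift (sym (+-identityʳ _))) ⟩
    descentSum + 2 * doubleDescentSum ∎
    where open ≡-Reasoning

  totalBraidDegree-descents : totalBraidDegree f ≡ descentSum + 2 * doubleDescentSum
  totalBraidDegree-descents = trans (totalBraidDegree-braidDegreeSum f) (braidDegreeSum-ℓ (ℓ f) refl)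

corollary4p9 : (n : ℕ) (σ : Permutation′ n) →
    totalBraidDegree (σ ⟨$⟩ʳ_)
      ≡ sum (map (λ i → totalBraidDegree ((σ ⟨$⟩ʳ_) ·s i)) (Des (σ ⟨$⟩ʳ_)))
        + 2 * sum (map (λ i → length (𝓡 ((((σ ⟨$⟩ʳ_) ·s i) ·s suc i) ·s i))) (DoubleDes (σ ⟨$⟩ʳ_)))
corollary4p9 n σ = begin
  totalBraidDegree f                         ≡⟨ totalBraidDegree-descents f ⟩
  descentSum f + 2 * doubleDescentSum f      ≡⟨ cong₂ (λ x y → x + 2 * y)
                                                  (sumMap-filter (isDescent? f) (λ i → totalBraidDegree (f ·s i)) (letters n))
                                                  (sumMap-filter (λ i → isDescent? f i ×-dec isDescent? f (suc i))
                                                                 (λ i → length (𝓡 (braidTriple f i))) (letters n)) ⟨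
  sumMap (λ i → totalBraidDegree (f ·s i)) (Des f) + 2 * sumMap (λ i → length (𝓡 (braidTriple f i))) (DoubleDes f) ∎
  where
  open ≡-Reasoning
  f = σ ⟨$⟩ʳ_
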